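{- In any execution of Algorithm A, if $id$ is the identifier of a correct process, then $id\in$ timely$_q$ for every correct process $q$.
   Context: System model: $N$ processes in a fully connected synchronous message-passing network with reliable channels; a receiver knows the label of the link on which a message arrived but not the sender's identifier; each correct process has a unique identifier initially known only to itself; up to $t$ processes are Byzantine (arbitrary behavior); throughout, $N>3t$. "Broadcast" means send to all $N$ links (including a self-loop). Id selection phase of Algorithm A (each correct process). Step 1: broadcast $\langle ID, my\_id\rangle$; Ids $:=$ set of identifiers received in ID messages. Step 2: for each $id\in$ Ids broadcast $\langle ECHO,id\rangle$; reset Ids to the set of $id$ for which $\langle ECHO,id\rangle$ was received on at least $N-t$ distinct links. Step 3: for each $id\in$ Ids broadcast $\langle READY,id\rangle$; timely $:=$ set of $id$ for which $\langle READY,id\rangle$ was received on at least $N-t$ distinct links; reset Ids to the set of $id$ for which $\langle READY,id\rangle$ was received on at least $N-2t$ distinct links and for which the process has not broadcast $\langle READY,id\rangle$. Step 4: for each $id\in$ Ids broadcast $\langle READY,id\rangle$; accepted $:=$ set of $id$ for which $\langle READY,id\rangle$ messages (Steps 3 and 4 together) were received on at least $N-t$ distinct links. -}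

module Defs where

open import Data.Nat using (ℕ; _≤_; _∸_; _≤?_)
open import Data.Nat.Properties using () renaming (_≟_ to _≟ℕ_)
open import Data.Fin using (Fin)
open import Data.Fin.Subset using (Subset; _∉_; ∣_∣)
open import Data.List using (List; []; _∷_; map; concatMap; filter; length; deduplicate)
open import Data.List.Membership.DecPropositional using ()
open import Data.Fin.Base using ()
open import Data.List using (allFin)
open import Relation.Nullary using (Dec; yes; no)
open import Relation.Binary.PropositionalEquality using (_≡_; refl; cong)
open import Function.Bundles using (_↔_; Inverse)

data Msg : Set where
  ID    : ℕ → Msg
  ECHO  : ℕ → Msg
  READY : ℕ → Msg

_≟ᴹ_ : (m m′ : Msg) → Dec (m ≡ m′)
ID x    ≟ᴹ ID y    with x ≟ℕ y
... | yes refl = yes refl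
... | no ne    = no λ { refl → ne refl }
ECHO x  ≟ᴹ ECHO y  with x ≟ℕ y
... | yes refl = yes refl
... | no ne    = no λ { refl → ne refl }
READY x ≟ᴹ READY y with x ≟ℕ y
... | yes refl = yes refl
... | no ne    = no λ { refl → ne refl }
ID _    ≟ᴹ ECHO _  = no λ ()
ID _    ≟ᴹ READY _ = no λ ()
ECHO _  ≟ᴹ ID _    = no λ ()
ECHO _  ≟ᴹ READY _ = no λ ()
READY _ ≟ᴹ ID _    = no λ ()
READY _ ≟ᴹ ECHO _  = no λ ()

open Data.List.Membership.DecPropositional _≟ᴹ_ using (_∈?_)

-- What a process receives in one round: for each local link label,
-- the list of messages that arrived on that link.
Inbox : ℕ → Set
Inbox N = Fin N → List Msg

linksWith : ∀ {N} → Msg → Inbox N → ℕ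
linksWith {N} m ib = length (filter (λ l → m ∈? ib l) (allFin N))

idOf : Msg → List ℕ
idOf (ID x) = x ∷ []
idOf _      = []

echoOf : Msg → List ℕ
echoOf (ECHO x) = x ∷ []
echoOf _        = []

allMsgs : ∀ {N} → Inbox N → List Msg
allMsgs {N} ib = concatMap ib (allFin N)

Ids₁ : ∀ {N} → Inbox N → List ℕ
Ids₁ ib = deduplicate _≟ℕ_ (concatMap idOf (allMsgs ib))

Ids₂ : ∀ {N} → ℕ → Inbox N → List ℕ
Ids₂ {N} t ib =
  filter (λ x → (N ∸ t) ≤? linksWith (ECHO x) ib)
         (deduplicate _≟ℕ_ (concatMap echoOf (allMsgs ib)))

timely : ∀ {N} → ℕ → Inbox N → ℕ → Set
timely {N} t ib x = N ∸ t ≤ linksWith (READY x) ib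

data Step : Set where
  step₁ step₂ step₃ : Step

record Execution (N t : ℕ) : Set where
  field
    faulty       : Subset N
    faulty-bound : ∣ faulty ∣ ≤ t
    myId         : Fin N → ℕ
    ids-unique   : ∀ p q → p ∉ faulty → q ∉ faulty → myId p ≡ myId q → p ≡ q
    -- port q : local link label at q ↦ the process at the other end of that link
    port         : Fin N → (Fin N ↔ Fin N)
    -- msg s p q : list of messages p sends to q in step s (arbitrary for faulty p)
    msg          : Step → Fin N → Fin N → List Msg

  inbox : Step → Fin N → Inbox N
  inbox s q l = msg s (Inverse.to (port q) l) q

  field
    correct-step₁ : ∀ p q → p ∉ faulty → msg step₁ p q ≡ ID (myId p) ∷ []
    correct-step₂ : ∀ p q → p ∉ faulty → msg step₂ p q ≡ map ECHO (Ids₁ (inbox step₁ p))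
    correct-step₃ : ∀ p q → p ∉ faulty → msg step₃ p q ≡ map READY (Ids₂ t (inbox step₂ p))

open Execution public

module Submission where

-- Every correct process p broadcasts ⟨ID, id_p⟩ in Step 1, so
-- every correct process r has id_p in its Step-1 set Ids and echoes it in
-- Step 2.  Hence every correct r receives ⟨ECHO, id_p⟩ from every correct
-- process, i.e. on at least N − t links, so id_p survives the Step-2 filter
-- and r sends ⟨READY, id_p⟩ in Step 3.  The same count at q shows that
-- ⟨READY, id_p⟩ arrives at q on at least N − t links: id_p is timely at q.

open import Defs
open import Data.Bool using (Bool; true; false)
open import Data.Nat using (ℕ; zero; suc; _*_; _<_; _≤_; _∸_; _≤?_)
open import Data.Nat.Properties using (_≟_; +-0-commutativeMonoid; ∸-monoʳ-≤; module ≤-Reasoning)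
open import Data.Fin using (Fin; zero; suc)
open import Data.Fin.Permutation using (Permutation; _⟨$⟩ʳ_; _⟨$⟩ˡ_; inverseʳ)
open import Data.Fin.Subset using (Subset; _⊆_; _∉_; ∁; ∣_∣) renaming (_∈_ to _∈ˢ_)
open import Data.Fin.Subset.Properties using (p⊆q⇒∣p∣≤∣q∣; ∣∁p∣≡n∸∣p∣; x∈∁p⇒x∉p)
open import Data.Vec using ([]; _∷_; lookup; tabulate)
open import Data.Vec.Properties using ([]=⇒lookup; lookup⇒[]=; lookup∘tabulate)
import Data.List as List
open import Data.List using (List; filter; length; concatMap; deduplicate)
open import Data.List.Membership.Propositional using (_∈_; lose)
open import Data.List.Membership.Propositional.Properties
  using (∈-allFin; ∈-concatMap⁺; ∈-deduplicate⁺; ∈-filter⁺; ∈-map⁺)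
open import Data.List.Membership.DecPropositional _≟ᴹ_ using (_∈?_)
open import Data.List.Relation.Unary.Any using (here)
open import Level using (0ℓ)
open import Relation.Nullary using (does)
open import Relation.Nullary.Decidable using (dec-true)
open import Relation.Unary using (Pred; Decidable)
open import Relation.Binary.PropositionalEquality
  using (_≡_; refl; sym; trans; cong; subst; module ≡-Reasoning)
open import Algebra.Properties.CommutativeMonoid.Sum +-0-commutativeMonoid
  using (sum; sum-cong-≗; sum-permute)

indicator : Bool → ℕ
indicator true  = 1
indicator false = 0

∣p∣≡∑ : ∀ {n} (p : Subset n) → ∣ p ∣ ≡ sum (λ i → indicator (lookup p i))
∣p∣≡∑ []          = refl
∣p∣≡∑ (true ∷ p)  = cong suc (∣p∣≡∑ p)
∣p∣≡∑ (false ∷ p) = ∣p∣≡∑ p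

∈-tabulate⁻ : ∀ {n} {b : Fin n → Bool} {i} → i ∈ˢ tabulate b → b i ≡ true
∈-tabulate⁻ {b = b} {i} i∈ = trans (sym (lookup∘tabulate b i)) ([]=⇒lookup i∈)

∈-tabulate⁺ : ∀ {n} {b : Fin n → Bool} {i} → b i ≡ true → i ∈ˢ tabulate b
∈-tabulate⁺ {b = b} {i} bi = lookup⇒[]= i (tabulate b) (trans (lookup∘tabulate b i) bi)

preimage : ∀ {m n} → (Fin m → Fin n) → Subset n → Subset m
preimage f p = tabulate (λ i → lookup p (f i))

∈-preimage⁻ : ∀ {m n} {f : Fin m → Fin n} {p : Subset n} {i} →
              i ∈ˢ preimage f p → f i ∈ˢ p
∈-preimage⁻ {f = f} {p} {i} i∈ = lookup⇒[]= (f i) p (∈-tabulate⁻ i∈)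

-- Preimages along a permutation have the same cardinality: this is how the
-- count of correct senders is transported to a count of a receiver's links.
∣preimage∣ : ∀ {m n} (π : Permutation m n) (p : Subset n) →
             ∣ preimage (π ⟨$⟩ʳ_) p ∣ ≡ ∣ p ∣
∣preimage∣ π p = begin
  ∣ preimage (π ⟨$⟩ʳ_) p ∣                              ≡⟨ ∣p∣≡∑ (preimage (π ⟨$⟩ʳ_) p) ⟩
  sum (λ i → indicator (lookup (preimage (π ⟨$⟩ʳ_) p) i)) ≡⟨ sum-cong-≗ (λ i → cong indicator (lookup∘tabulate (λ j → lookup p (π ⟨$⟩ʳ j)) i)) ⟩
  sum (λ i → indicator (lookup p (π ⟨$⟩ʳ i)))            ≡⟨ sum-permute (λ j → indicator (lookup p j)) π ⟨
  sum (λ j → indicator (lookup p j))                      ≡⟨ ∣p∣≡∑ p ⟨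
  ∣ p ∣                                                   ∎
  where open ≡-Reasoning

satisfying : ∀ {n} {P : Pred (Fin n) 0ℓ} → Decidable P → Subset n
satisfying P? = tabulate (λ i → does (P? i))

∈-satisfying⁺ : ∀ {n} {P : Pred (Fin n) 0ℓ} (P? : Decidable P) {i} → P i → i ∈ˢ satisfying P?
∈-satisfying⁺ P? {i} Pi = ∈-tabulate⁺ (dec-true (P? i) Pi)

-- Counting by filtering a tabulated list is the cardinality of a subset;
-- for f the identity this identifies the number of links in 'linksWith'.
length-filter-tabulate : ∀ {A : Set} {P : Pred A 0ℓ} (P? : Decidable P) {n} (f : Fin n → A) →
                         length (filter P? (List.tabulate f)) ≡ ∣ tabulate (λ i → does (P? (f i))) ∣
length-filter-tabulate P? {zero}  f = refl
length-filter-tabulate P? {suc n} f with does (P? (f zero))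
... | true  = cong suc (length-filter-tabulate P? (λ i → f (suc i)))
... | false = length-filter-tabulate P? (λ i → f (suc i))

module _ {N t : ℕ} (E : Execution N t) where

  -- The links of q whose
  -- sender is correct are the preimage of the correct set under q's port
  -- permutation, so there are N − |faulty| ≥ N − t of them.
  quorum : ∀ s q m → (∀ r → r ∉ faulty E → m ∈ msg E s r q) →
           N ∸ t ≤ linksWith m (inbox E s q)
  quorum s q m sentByCorrect = begin
    N ∸ t                          ≤⟨ ∸-monoʳ-≤ N (faulty-bound E) ⟩
    N ∸ ∣ F ∣                      ≡⟨ ∣∁p∣≡n∸∣p∣ F ⟨
    ∣ ∁ F ∣                        ≡⟨ ∣preimage∣ (port E q) (∁ F) ⟨
    ∣ preimage sender (∁ F) ∣      ≤⟨ p⊆q⇒∣p∣≤∣q∣ correctLinks⊆mLinks ⟩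
    ∣ satisfying arrivedOn? ∣      ≡⟨ length-filter-tabulate arrivedOn? (λ l → l) ⟨
    linksWith m (inbox E s q)      ∎
    where
      open ≤-Reasoning
      F = faulty E
      sender = port E q ⟨$⟩ʳ_
      arrivedOn? = λ l → m ∈? inbox E s q l

      correctLinks⊆mLinks : preimage sender (∁ F) ⊆ satisfying arrivedOn?
      correctLinks⊆mLinks l∈ =
        ∈-satisfying⁺ arrivedOn? (sentByCorrect (sender _) (x∈∁p⇒x∉p (∈-preimage⁻ l∈)))

  -- A message sent by r to q in step s is among all messages q receives
  -- then: it arrives on the link of q that the port permutation assigns to r.
  received : ∀ s r q {m} → m ∈ msg E s r q → m ∈ allMsgs (inbox E s q)
  received s r q {m} m∈ = ∈-concatMap⁺ (inbox E s q) (lose (∈-allFin (port E q ⟨$⟩ˡ r)) m∈inbox)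
    where
      m∈inbox : m ∈ inbox E s q (port E q ⟨$⟩ˡ r)
      m∈inbox = subst (λ x → m ∈ msg E s x q) (sym (inverseʳ (port E q))) m∈

  collected : ∀ s r q (carried : Msg → List ℕ) {m x} → x ∈ carried m → m ∈ msg E s r q →
              x ∈ deduplicate _≟_ (concatMap carried (allMsgs (inbox E s q)))
  collected s r q carried x∈m m∈ =
    ∈-deduplicate⁺ _≟_ (∈-concatMap⁺ carried (lose (received s r q m∈) x∈m))

  id-in-Ids₁ : ∀ p r → p ∉ faulty E → myId E p ∈ Ids₁ (inbox E step₁ r)
  id-in-Ids₁ p r p-correct =
    collected step₁ p r idOf (here refl)
      (subst (ID (myId E p) ∈_) (sym (correct-step₁ E p r p-correct)) (here refl))

  -- Step 2: every correct process echoes it to everyone, so by the quorum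
  -- lemma it passes the N − t echo threshold at every correct process.
  id-in-Ids₂ : ∀ p r → p ∉ faulty E → r ∉ faulty E → myId E p ∈ Ids₂ t (inbox E step₂ r)
  id-in-Ids₂ p r p-correct r-correct =
    ∈-filter⁺ (λ x → N ∸ t ≤? linksWith (ECHO x) (inbox E step₂ r))
      (collected step₂ r r echoOf (here refl) (echoed r r-correct))
      (quorum step₂ r (ECHO (myId E p)) echoed)
    where
      echoed : ∀ r′ → r′ ∉ faulty E → ECHO (myId E p) ∈ msg E step₂ r′ r
      echoed r′ r′-correct = subst (ECHO (myId E p) ∈_) (sym (correct-step₂ E r′ r r′-correct))
                                   (∈-map⁺ ECHO (id-in-Ids₁ p r′ p-correct))

-- Lemma 2: the identifier of a correct process p is timely at every correct q,
-- because every correct process sends ⟨READY, id_p⟩ to q in Step 3.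
lemma2 : ∀ {N t : ℕ} → 3 * t < N → (E : Execution N t) → (p q : Fin N) →
         p ∉ faulty E → q ∉ faulty E →
         timely t (inbox E step₃ q) (myId E p)
lemma2 _ E p q p-correct _ = quorum E step₃ q (READY (myId E p)) readied
  where
    readied : ∀ r → r ∉ faulty E → READY (myId E p) ∈ msg E step₃ r q
    readied r r-correct = subst (READY (myId E p) ∈_) (sym (correct-step₃ E r q r-correct))
                                (∈-map⁺ READY (id-in-Ids₂ E p r p-correct r-correct))
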